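{- For every CCCP configuration $\mathcal C$ and system terms $W_1,W_2$: if $\mathcal C\xrightarrow{\sigma}W_1$ and $\mathcal C\xrightarrow{\sigma}W_2$ then $W_1=W_2$.
   Context: The calculus CCCP. Fix a set of channels ranged over by $c,d$, and a set of values containing data variables $x,y$ and a distinguished error value $\mathtt{err}$; every closed value $v$ has a transmission time $\delta_v$, a positive integer. Expressions $e$ are built from values, with an evaluation map $[\![\cdot]\!]$ sending variable-free expressions to closed values; Boolean expressions $b$ are $e_1=e_2$ or $\mathrm{exp}(c)$. Processes: $P,Q ::= c!\langle e\rangle.P \mid \lfloor c?(x).P\rfloor Q \mid \sigma.P \mid \tau.P \mid P+Q \mid [b]P,Q \mid X \mid \mathbf{nil} \mid \mathrm{fix}\,X.P$. System terms: $W ::= P \mid \lceil c?(x).P\rceil \mid W_1\,|\,W_2 \mid \nu c{:}(n,v).W$ ($n\in\mathbb N$, $v$ closed). $x$ is bound in $P$ in both input forms, $X$ in $\mathrm{fix}\,X.P$, $c$ in $\nu c{:}(n,v).W$; terms are up to $\alpha$-conversion. In $\mathrm{fix}\,X.P$ every occurrence of $X$ in $P$ is guarded (inside a broadcast prefix, body or timeout branch of an input, a $\sigma$-prefix, or a matching branch). $\sigma^n.P$ denotes $n$ nested $\sigma$-prefixes. A channel environment $\Gamma$ maps channels to $\mathbb N\times\{\text{closed values}\}$; $\Gamma\vdash_t c:n$, $\Gamma\vdash_v c:w$ mean $\Gamma(c)=(n,w)$; $c$ is idle if $n=0$, exposed otherwise; $\Gamma[c\mapsto(n,v)]$ is the update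 at $c$. $c!v(\Gamma)$ agrees with $\Gamma$ except at $c$, where it is $(\delta_v,v)$ if $c$ idle in $\Gamma$ and $(\max(\delta_v,t_c),\mathtt{err})$ if exposed with $\Gamma\vdash_t c:t_c$. $[\![e_1=e_2]\!]_\Gamma$ true iff $[\![e_1]\!]=[\![e_2]\!]$; $[\![\mathrm{exp}(c)]\!]_\Gamma$ true iff $c$ exposed in $\Gamma$. $\mathrm{rcv}(W,c)$: true for $\lfloor c?(x).P\rfloor Q$; disjunctive over $+$ and $|$; $\mathrm{rcv}(\mathrm{fix}\,X.P,c)=\mathrm{rcv}(P,c)$; $\mathrm{rcv}(\nu d{:}(n,v).W,c)=\mathrm{rcv}(W,c)$ for $d\ne c$; false otherwise. $\mathrm{rcv}(\Gamma\triangleright W,c)$ iff $c$ idle in $\Gamma$ and $\mathrm{rcv}(W,c)$. A configuration $\Gamma\triangleright W$ has $W$ closed. Intensional transitions $\Gamma\triangleright W\xrightarrow{\lambda}W'$, $\lambda\in\{c!v,c?v,\sigma,\tau\}$, form the least relation closed under: (Snd) $[\![e]\!]=v$ gives $\Gamma\triangleright c!\langle e\rangle.P\xrightarrow{c!v}\sigma^{\delta_v}.P$; (Rcv) $c$ idle gives $\Gamma\triangleright\lfloor c?(x).P\rfloor Q\xrightarrow{c?v}\lceil c?(x).P\rceil$; (RcvIgn) not $\mathrm{rcv}(\Gamma\triangleright W,c)$ gives $\Gamma\triangleright W\xrightarrow{c?v}W$; (Sync) $W_1\xrightarrow{c!v}W_1'$, $W_2\xrightarrow{c?v}W_2'$ (under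 $\Gamma$) give $W_1|W_2\xrightarrow{c!v}W_1'|W_2'$, and symmetrically; (RcvPar) $W_i\xrightarrow{c?v}W_i'$ give $W_1|W_2\xrightarrow{c?v}W_1'|W_2'$; (TimeNil) $\mathbf{nil}\xrightarrow{\sigma}\mathbf{nil}$; (Sleep) $\sigma.P\xrightarrow{\sigma}P$; (ActRcv) $\Gamma\vdash_t c:n>1$ gives $\lceil c?(x).P\rceil\xrightarrow{\sigma}\lceil c?(x).P\rceil$; (EndRcv) $\Gamma\vdash_t c:1$, $\Gamma\vdash_v c:w$ give $\lceil c?(x).P\rceil\xrightarrow{\sigma}\{w/x\}P$; (Timeout) $c$ idle gives $\lfloor c?(x).P\rfloor Q\xrightarrow{\sigma}Q$; (RcvLate) $c$ exposed gives $\lfloor c?(x).P\rfloor Q\xrightarrow{\tau}\lceil c?(x).\{\mathtt{err}/x\}P\rceil$; (Tau) $\tau.P\xrightarrow{\tau}P$; (Then)/(Else) $[b]P,Q\xrightarrow{\tau}\sigma.P$ if $[\![b]\!]_\Gamma$ true, $\xrightarrow{\tau}\sigma.Q$ if false; (TimePar) $W_i\xrightarrow{\sigma}W_i'$ give $W_1|W_2\xrightarrow{\sigma}W_1'|W_2'$; (TauPar) $W_1\xrightarrow{\tau}W_1'$ gives $W_1|W_2\xrightarrow{\tau}W_1'|W_2$, and symmetrically; (Rec) $\{\mathrm{fix}\,X.P/X\}P\xrightarrow{\lambda}W$ gives $\mathrm{fix}\,X.P\xrightarrow{\lambda}W$; (Sum) $P\xrightarrow{\lambda}W$, $\lambda\in\{\tau,c!v\}$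 gives $P+Q\xrightarrow{\lambda}W$, and symmetrically; (SumTime) $P\xrightarrow{\sigma}P'$, $Q\xrightarrow{\sigma}Q'$ give $P+Q\xrightarrow{\sigma}P'+Q'$; (SumRcv) $P\xrightarrow{c?v}W$ and $\mathrm{rcv}(\Gamma\triangleright P,c)$ give $P+Q\xrightarrow{c?v}W$, and symmetrically; (ResI) $\Gamma[c\mapsto(n,v)]\triangleright W\xrightarrow{c!w}W'$ gives $\Gamma\triangleright\nu c{:}(n,v).W\xrightarrow{\tau}\nu c{:}(c!w(\Gamma[c\mapsto(n,v)])(c)).W'$; (ResV) $\Gamma[c\mapsto(n,v)]\triangleright W\xrightarrow{\lambda}W'$ with $c$ not in $\lambda$ gives $\Gamma\triangleright\nu c{:}(n,v).W\xrightarrow{\lambda}\nu c{:}(n,v).W'$. -}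

module Defs where

open import Data.Nat using (ℕ; zero; suc; _≤_; _<_; _⊔_)
open import Data.Product using (_×_; _,_; proj₁; proj₂; Σ)
open import Data.List using (List; []; _∷_)
open import Data.List.Membership.Propositional using (_∈_)
open import Data.Unit using (⊤)
open import Relation.Nullary using (¬_; yes; no)
open import Relation.Binary.Definitions using (DecidableEquality)
open import Relation.Binary.PropositionalEquality using (_≡_; _≢_)

record Setting : Set₁ where
  field
    Chan    : Set
    _≟ᶜ_    : DecidableEquality Chan
    Var     : Set
    _≟ᵛ_    : DecidableEquality Var
    CVal    : Set
    err     : CVal
    δ       : CVal → ℕ                  -- transmission time
    δ-pos   : ∀ v → 1 ≤ δ v
    Exp     : Set
    FreeIn  : Var → Exp → Set
    substE  : Var → CVal → Exp → Exp
    eval    : (e : Exp) → (∀ x → ¬ FreeIn x e) → CVal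

PVar : Set
PVar = ℕ

module Calculus (S : Setting) where
  open Setting S

  data BExp : Set where
    _==_ : Exp → Exp → BExp
    exp  : Chan → BExp

  data Proc : Set where
    out   : Chan → Exp → Proc → Proc
    inp   : Chan → Var → Proc → Proc → Proc    -- ⌊c?(x).P⌋Q
    sleep : Proc → Proc
    tau   : Proc → Proc
    _⊕_   : Proc → Proc → Proc
    cond  : BExp → Proc → Proc → Proc
    pvar  : PVar → Proc
    nil   : Proc
    fix   : PVar → Proc → Proc

  data Sys : Set where
    proc   : Proc → Sys
    active : Chan → Var → Proc → Sys
    _∥_    : Sys → Sys → Sys
    ν      : Chan → ℕ → CVal → Sys → Sys

  sleeps : ℕ → Proc → Proc
  sleeps zero    P = P
  sleeps (suc n) P = sleep (sleeps n P)

  ClosedE : List Var → Exp → Set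
  ClosedE Δ e = ∀ x → FreeIn x e → x ∈ Δ

  ClosedB : List Var → BExp → Set
  ClosedB Δ (e₁ == e₂) = ClosedE Δ e₁ × ClosedE Δ e₂
  ClosedB Δ (exp c)    = ⊤

  data ClosedP (Δ : List Var) (Ξ : List PVar) : Proc → Set where
    out   : ∀ {c e P} → ClosedE Δ e → ClosedP Δ Ξ P → ClosedP Δ Ξ (out c e P)
    inp   : ∀ {c x P Q} → ClosedP (x ∷ Δ) Ξ P → ClosedP Δ Ξ Q → ClosedP Δ Ξ (inp c x P Q)
    sleep : ∀ {P} → ClosedP Δ Ξ P → ClosedP Δ Ξ (sleep P)
    tau   : ∀ {P} → ClosedP Δ Ξ P → ClosedP Δ Ξ (tau P)
    sum   : ∀ {P Q} → ClosedP Δ Ξ P → ClosedP Δ Ξ Q → ClosedP Δ Ξ (P ⊕ Q)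
    cond  : ∀ {b P Q} → ClosedB Δ b → ClosedP Δ Ξ P → ClosedP Δ Ξ Q → ClosedP Δ Ξ (cond b P Q)
    pvar  : ∀ {X} → X ∈ Ξ → ClosedP Δ Ξ (pvar X)
    nil   : ClosedP Δ Ξ nil
    fix   : ∀ {X P} → ClosedP Δ (X ∷ Ξ) P → ClosedP Δ Ξ (fix X P)

  data ClosedW : Sys → Set where
    proc   : ∀ {P} → ClosedP [] [] P → ClosedW (proc P)
    active : ∀ {c x P} → ClosedP (x ∷ []) [] P → ClosedW (active c x P)
    par    : ∀ {W₁ W₂} → ClosedW W₁ → ClosedW W₂ → ClosedW (W₁ ∥ W₂)
    nu     : ∀ {c n v W} → ClosedW W → ClosedW (ν c n v W)

  data Unguarded (X : PVar) : Proc → Set where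
    var  : Unguarded X (pvar X)
    tau  : ∀ {P} → Unguarded X P → Unguarded X (tau P)
    sumL : ∀ {P Q} → Unguarded X P → Unguarded X (P ⊕ Q)
    sumR : ∀ {P Q} → Unguarded X Q → Unguarded X (P ⊕ Q)
    fix  : ∀ {Y P} → Y ≢ X → Unguarded X P → Unguarded X (fix Y P)

  data GuardedP : Proc → Set where
    out   : ∀ {c e P} → GuardedP P → GuardedP (out c e P)
    inp   : ∀ {c x P Q} → GuardedP P → GuardedP Q → GuardedP (inp c x P Q)
    sleep : ∀ {P} → GuardedP P → GuardedP (sleep P)
    tau   : ∀ {P} → GuardedP P → GuardedP (tau P)
    sum   : ∀ {P Q} → GuardedP P → GuardedP Q → GuardedP (P ⊕ Q)
    cond  : ∀ {b P Q} → GuardedP P → GuardedP Q → GuardedP (cond b P Q)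
    pvar  : ∀ {X} → GuardedP (pvar X)
    nil   : GuardedP nil
    fix   : ∀ {X P} → ¬ Unguarded X P → GuardedP P → GuardedP (fix X P)

  data GuardedW : Sys → Set where
    proc   : ∀ {P} → GuardedP P → GuardedW (proc P)
    active : ∀ {c x P} → GuardedP P → GuardedW (active c x P)
    par    : ∀ {W₁ W₂} → GuardedW W₁ → GuardedW W₂ → GuardedW (W₁ ∥ W₂)
    nu     : ∀ {c n v W} → GuardedW W → GuardedW (ν c n v W)

  -- Substitutions (the substituted terms are closed, so no capture)

  substB : Var → CVal → BExp → BExp
  substB x w (e₁ == e₂) = substE x w e₁ == substE x w e₂
  substB x w (exp c)    = exp c

  substP : Var → CVal → Proc → Proc
  substP x w (out c e P) = out c (substE x w e) (substP x w P)
  substP x w (inp c y P Q) with y ≟ᵛ x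
  ... | yes _ = inp c y P (substP x w Q)
  ... | no  _ = inp c y (substP x w P) (substP x w Q)
  substP x w (sleep P)    = sleep (substP x w P)
  substP x w (tau P)      = tau (substP x w P)
  substP x w (P ⊕ Q)      = substP x w P ⊕ substP x w Q
  substP x w (cond b P Q) = cond (substB x w b) (substP x w P) (substP x w Q)
  substP x w (pvar X)     = pvar X
  substP x w nil          = nil
  substP x w (fix X P)    = fix X (substP x w P)

  psubst : PVar → Proc → Proc → Proc
  psubst X R (out c e P)   = out c e (psubst X R P)
  psubst X R (inp c y P Q) = inp c y (psubst X R P) (psubst X R Q)
  psubst X R (sleep P)     = sleep (psubst X R P)
  psubst X R (tau P)       = tau (psubst X R P)
  psubst X R (P ⊕ Q)       = psubst X R P ⊕ psubst X R Q
  psubst X R (cond b P Q)  = cond b (psubst X R P) (psubst X R Q)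
  psubst X R (pvar Y) with Y Data.Nat.≟ X
  ... | yes _ = R
  ... | no  _ = pvar Y
  psubst X R nil           = nil
  psubst X R (fix Y P) with Y Data.Nat.≟ X
  ... | yes _ = fix Y P
  ... | no  _ = fix Y (psubst X R P)

  Env : Set
  Env = Chan → ℕ × CVal

  Idle : Env → Chan → Set
  Idle Γ c = proj₁ (Γ c) ≡ 0

  Exposed : Env → Chan → Set
  Exposed Γ c = 0 < proj₁ (Γ c)

  _[_↦_] : Env → Chan → ℕ × CVal → Env
  (Γ [ c ↦ p ]) d with d ≟ᶜ c
  ... | yes _ = p
  ... | no  _ = Γ d

  sendEntry : ℕ × CVal → CVal → ℕ × CVal
  sendEntry (zero  , _) v = (δ v , v)
  sendEntry (suc t , _) v = (δ v ⊔ suc t , err)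

  sendEnv : Chan → CVal → Env → Env
  sendEnv c v Γ = Γ [ c ↦ sendEntry (Γ c) v ]

  Holds : Env → BExp → Set
  Holds Γ (e₁ == e₂) =
    Σ (∀ x → ¬ FreeIn x e₁) λ p₁ → Σ (∀ x → ¬ FreeIn x e₂) λ p₂ → eval e₁ p₁ ≡ eval e₂ p₂
  Holds Γ (exp c) = Exposed Γ c

  data RcvP (c : Chan) : Proc → Set where
    here : ∀ {x P Q} → RcvP c (inp c x P Q)
    sumL : ∀ {P Q} → RcvP c P → RcvP c (P ⊕ Q)
    sumR : ∀ {P Q} → RcvP c Q → RcvP c (P ⊕ Q)
    fix  : ∀ {X P} → RcvP c P → RcvP c (fix X P)

  data RcvW (c : Chan) : Sys → Set where
    proc : ∀ {P} → RcvP c P → RcvW c (proc P)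
    parL : ∀ {W₁ W₂} → RcvW c W₁ → RcvW c (W₁ ∥ W₂)
    parR : ∀ {W₁ W₂} → RcvW c W₂ → RcvW c (W₁ ∥ W₂)
    nu   : ∀ {d n v W} → d ≢ c → RcvW c W → RcvW c (ν d n v W)

  RcvC : Env → Sys → Chan → Set
  RcvC Γ W c = Idle Γ c × RcvW c W

  data Label : Set where
    snd! : Chan → CVal → Label
    rcv? : Chan → CVal → Label
    σ    : Label
    τ    : Label

  NotIn : Chan → Label → Set
  NotIn c (snd! d v) = d ≢ c
  NotIn c (rcv? d v) = d ≢ c
  NotIn c σ = ⊤
  NotIn c τ = ⊤

  infix 4 _⊢_—[_]→_

  data _⊢_—[_]→_ (Γ : Env) : Sys → Label → Sys → Set where
    Snd     : ∀ {c e P v} (p : ∀ x → ¬ FreeIn x e) → eval e p ≡ v →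
              Γ ⊢ proc (out c e P) —[ snd! c v ]→ proc (sleeps (δ v) P)
    Rcv     : ∀ {c x P Q v} → Idle Γ c →
              Γ ⊢ proc (inp c x P Q) —[ rcv? c v ]→ active c x P
    RcvIgn  : ∀ {W c v} → ¬ RcvC Γ W c → Γ ⊢ W —[ rcv? c v ]→ W
    SyncL   : ∀ {W₁ W₂ W₁' W₂' c v} →
              Γ ⊢ W₁ —[ snd! c v ]→ W₁' → Γ ⊢ W₂ —[ rcv? c v ]→ W₂' →
              Γ ⊢ W₁ ∥ W₂ —[ snd! c v ]→ W₁' ∥ W₂'
    SyncR   : ∀ {W₁ W₂ W₁' W₂' c v} →
              Γ ⊢ W₁ —[ rcv? c v ]→ W₁' → Γ ⊢ W₂ —[ snd! c v ]→ W₂' →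
              Γ ⊢ W₁ ∥ W₂ —[ snd! c v ]→ W₁' ∥ W₂'
    RcvPar  : ∀ {W₁ W₂ W₁' W₂' c v} →
              Γ ⊢ W₁ —[ rcv? c v ]→ W₁' → Γ ⊢ W₂ —[ rcv? c v ]→ W₂' →
              Γ ⊢ W₁ ∥ W₂ —[ rcv? c v ]→ W₁' ∥ W₂'
    TimeNil : Γ ⊢ proc nil —[ σ ]→ proc nil
    Sleep   : ∀ {P} → Γ ⊢ proc (sleep P) —[ σ ]→ proc P
    ActRcv  : ∀ {c x P} → 1 < proj₁ (Γ c) →
              Γ ⊢ active c x P —[ σ ]→ active c x P
    EndRcv  : ∀ {c x P w} → proj₁ (Γ c) ≡ 1 → proj₂ (Γ c) ≡ w →
              Γ ⊢ active c x P —[ σ ]→ proc (substP x w P)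
    Timeout : ∀ {c x P Q} → Idle Γ c →
              Γ ⊢ proc (inp c x P Q) —[ σ ]→ proc Q
    RcvLate : ∀ {c x P Q} → Exposed Γ c →
              Γ ⊢ proc (inp c x P Q) —[ τ ]→ active c x (substP x err P)
    Tau     : ∀ {P} → Γ ⊢ proc (tau P) —[ τ ]→ proc P
    Then    : ∀ {b P Q} → Holds Γ b →
              Γ ⊢ proc (cond b P Q) —[ τ ]→ proc (sleep P)
    Else    : ∀ {b P Q} → ¬ Holds Γ b →
              Γ ⊢ proc (cond b P Q) —[ τ ]→ proc (sleep Q)
    TimePar : ∀ {W₁ W₂ W₁' W₂'} →
              Γ ⊢ W₁ —[ σ ]→ W₁' → Γ ⊢ W₂ —[ σ ]→ W₂' →
              Γ ⊢ W₁ ∥ W₂ —[ σ ]→ W₁' ∥ W₂'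
    TauParL : ∀ {W₁ W₂ W₁'} → Γ ⊢ W₁ —[ τ ]→ W₁' → Γ ⊢ W₁ ∥ W₂ —[ τ ]→ W₁' ∥ W₂
    TauParR : ∀ {W₁ W₂ W₂'} → Γ ⊢ W₂ —[ τ ]→ W₂' → Γ ⊢ W₁ ∥ W₂ —[ τ ]→ W₁ ∥ W₂'
    Rec     : ∀ {X P λ' W} → Γ ⊢ proc (psubst X (fix X P) P) —[ λ' ]→ W →
              Γ ⊢ proc (fix X P) —[ λ' ]→ W
    SumTauL : ∀ {P Q W} → Γ ⊢ proc P —[ τ ]→ W → Γ ⊢ proc (P ⊕ Q) —[ τ ]→ W
    SumTauR : ∀ {P Q W} → Γ ⊢ proc Q —[ τ ]→ W → Γ ⊢ proc (P ⊕ Q) —[ τ ]→ W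
    SumSndL : ∀ {P Q W c v} → Γ ⊢ proc P —[ snd! c v ]→ W → Γ ⊢ proc (P ⊕ Q) —[ snd! c v ]→ W
    SumSndR : ∀ {P Q W c v} → Γ ⊢ proc Q —[ snd! c v ]→ W → Γ ⊢ proc (P ⊕ Q) —[ snd! c v ]→ W
    SumTime : ∀ {P Q P' Q'} → Γ ⊢ proc P —[ σ ]→ proc P' → Γ ⊢ proc Q —[ σ ]→ proc Q' →
              Γ ⊢ proc (P ⊕ Q) —[ σ ]→ proc (P' ⊕ Q')
    SumRcvL : ∀ {P Q W c v} → Γ ⊢ proc P —[ rcv? c v ]→ W → RcvC Γ (proc P) c →
              Γ ⊢ proc (P ⊕ Q) —[ rcv? c v ]→ W
    SumRcvR : ∀ {P Q W c v} → Γ ⊢ proc Q —[ rcv? c v ]→ W → RcvC Γ (proc Q) c →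
              Γ ⊢ proc (P ⊕ Q) —[ rcv? c v ]→ W
    ResI    : ∀ {c n v W W' w} → (Γ [ c ↦ (n , v) ]) ⊢ W —[ snd! c w ]→ W' →
              Γ ⊢ ν c n v W —[ τ ]→
                ν c (proj₁ (sendEnv c w (Γ [ c ↦ (n , v) ]) c))
                    (proj₂ (sendEnv c w (Γ [ c ↦ (n , v) ]) c)) W'
    ResV    : ∀ {c n v W W' λ'} → (Γ [ c ↦ (n , v) ]) ⊢ W —[ λ' ]→ W' → NotIn c λ' →
              Γ ⊢ ν c n v W —[ λ' ]→ ν c n v W'

-- The σ-transition rules are syntax directed: for each shape of system
-- term at most one rule can conclude a σ-step, and the premises of that
-- rule are σ-steps of immediate subterms (or of the unfolding, for Rec)
-- under an environment fixed by the conclusion.  The only shape with two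
-- candidate rules is an active receiver ⌈c?(x).P⌉, where ActRcv needs the
-- timer of c to exceed 1 and EndRcv needs it to equal 1; these conditions
-- exclude each other, and EndRcv delivers the value recorded in Γ.
--
-- The theorem follows directly.
module Submission where

open import Defs
open import Data.Nat using (ℕ; _<_)
open import Data.Nat.Properties using (<-irrefl)
open import Data.Empty using (⊥; ⊥-elim)
open import Relation.Binary.PropositionalEquality using (_≡_; refl; cong; cong₂)

module TimeDeterminism (S : Setting) where
  open Calculus S

  running-not-ending : ∀ {n : ℕ} → 1 < n → n ≡ 1 → ⊥
  running-not-ending 1<n refl = <-irrefl refl 1<n

  proc-injective : ∀ {P Q : Proc} → proc P ≡ proc Q → P ≡ Q
  proc-injective refl = refl

  σ-deterministic : ∀ {Γ W W₁ W₂} →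
    Γ ⊢ W —[ σ ]→ W₁ → Γ ⊢ W —[ σ ]→ W₂ → W₁ ≡ W₂
  σ-deterministic TimeNil          TimeNil          = refl
  σ-deterministic Sleep            Sleep            = refl
  σ-deterministic (Timeout _)      (Timeout _)      = refl
  σ-deterministic (ActRcv _)       (ActRcv _)       = refl
  σ-deterministic (ActRcv 1<n)     (EndRcv n≡1 _)   = ⊥-elim (running-not-ending 1<n n≡1)
  σ-deterministic (EndRcv n≡1 _)   (ActRcv 1<n)     = ⊥-elim (running-not-ending 1<n n≡1)
  σ-deterministic (EndRcv _ refl)  (EndRcv _ refl)  = refl
  σ-deterministic (Rec t₁)         (Rec t₂)         = σ-deterministic t₁ t₂
  σ-deterministic (ResV t₁ _)      (ResV t₂ _)      = cong (ν _ _ _) (σ-deterministic t₁ t₂)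
  σ-deterministic (TimePar l₁ r₁)  (TimePar l₂ r₂)  =
    cong₂ _∥_ (σ-deterministic l₁ l₂) (σ-deterministic r₁ r₂)
  σ-deterministic (SumTime l₁ r₁)  (SumTime l₂ r₂)  =
    cong₂ (λ P Q → proc (P ⊕ Q))
      (proc-injective (σ-deterministic l₁ l₂))
      (proc-injective (σ-deterministic r₁ r₂))

mainTheorem5 : (S : Setting) → let open Calculus S in
    (Γ : Env) (W W₁ W₂ : Sys) → ClosedW W → GuardedW W →
    Γ ⊢ W —[ σ ]→ W₁ → Γ ⊢ W —[ σ ]→ W₂ → W₁ ≡ W₂
mainTheorem5 S Γ W W₁ W₂ _ _ = TimeDeterminism.σ-deterministic S
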